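{- Let $m$ be a positive integer and $d,e\ge 0$ integers. Let $M$ be a matroid of rank $d+m$ on a set $E$ and $U$ a uniform matroid of rank $e+m$ on a set $E'$ disjoint from $E$. Fix a total order on $E\cup E'$ in which every element of $E$ is smaller than every element of $E'$. Let $B$ be a basis of $\tau^m(M\oplus U)$. If $|B\cap E|\neq d$, then every element that is externally active with respect to $B$ lies in $E$. If $|B\cap E|\neq d+m$, then every element that is internally active with respect to $B$ lies in $E$.
   Context: For a matroid of positive rank, its truncation $\tau$ has as independent sets the independent sets of the original matroid that are not bases; $\tau^m$ is $m$-fold iterated truncation. For a matroid on a totally ordered ground set $S$ with basis $B$: $v\in B$ is internally active if $v$ is the smallest element of the unique cocircuit contained in $(S-B)\cup\{v\}$; $v\in S-B$ is externally active if $v$ is the smallest element of the unique circuit contained in $B\cup\{v\}$. Activities here are computed in the matroid $\tau^m(M\oplus U)$. -}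

module Defs where

open import Data.Nat using (ℕ; zero; suc; _+_; _≤_; _<_)
open import Data.Fin using (Fin; _↑ˡ_)
open import Data.Fin.Subset using (Subset; ⊥; ⁅_⁆; _∈_; _∉_; _⊆_; ∁; _∩_; _∪_; ∣_∣; Empty)
open import Data.Vec using (take; drop)
open import Data.Product using (_×_; ∃; Σ)
open import Relation.Nullary using (¬_)
open import Relation.Binary.PropositionalEquality using (_≡_; _≢_)

IndepPred : ℕ → Set₁
IndepPred n = Subset n → Set

record IsMatroid {n : ℕ} (P : IndepPred n) : Set where
  field
    empty-indep : P ⊥
    hereditary  : ∀ I J → J ⊆ I → P I → P J
    augment     : ∀ I J → P I → P J → ∣ I ∣ < ∣ J ∣ →
                  ∃ λ x → x ∈ J × x ∉ I × P (I ∪ ⁅ x ⁆)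

HasRank : {n : ℕ} → IndepPred n → ℕ → Set
HasRank P r = (∃ λ I → P I × ∣ I ∣ ≡ r) × (∀ I → P I → ∣ I ∣ ≤ r)

IsBasis : {n : ℕ} → IndepPred n → Subset n → Set
IsBasis P B = P B × (∀ J → B ⊆ J → P J → J ≡ B)

trunc : {n : ℕ} → IndepPred n → IndepPred n
trunc P I = P I × ¬ IsBasis P I

truncIter : {n : ℕ} → ℕ → IndepPred n → IndepPred n
truncIter zero    P = P
truncIter (suc m) P = trunc (truncIter m P)

uniform : (k r : ℕ) → IndepPred k
uniform k r I = ∣ I ∣ ≤ r

directSum : {n k : ℕ} → IndepPred n → IndepPred k → IndepPred (n + k)
directSum {n} P Q I = P (take n I) × Q (drop n I)

IsCircuit : {n : ℕ} → IndepPred n → Subset n → Set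
IsCircuit P C = ¬ P C × (∀ D → D ⊆ C → D ≢ C → P D)

dual : {n : ℕ} → IndepPred n → IndepPred n
dual P I = ∃ λ B → IsBasis P B × Empty (I ∩ B)

IsCocircuit : {n : ℕ} → IndepPred n → Subset n → Set
IsCocircuit P D = IsCircuit (dual P) D

IsSmallest : {n : ℕ} → (Fin n → Fin n → Set) → Fin n → Subset n → Set
IsSmallest _≺_ v C = v ∈ C × (∀ w → w ∈ C → w ≢ v → v ≺ w)

ExternallyActive : {n : ℕ} → IndepPred n → (Fin n → Fin n → Set) →
                   Subset n → Fin n → Set
ExternallyActive P _≺_ B v =
  v ∉ B × ∃ λ C → IsCircuit P C × C ⊆ (B ∪ ⁅ v ⁆) × IsSmallest _≺_ v C

InternallyActive : {n : ℕ} → IndepPred n → (Fin n → Fin n → Set) →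
                   Subset n → Fin n → Set
InternallyActive P _≺_ B v =
  v ∈ B × ∃ λ D → IsCocircuit P D × D ⊆ (∁ B ∪ ⁅ v ⁆) × IsSmallest _≺_ v D

InE : (n k : ℕ) → Fin (n + k) → Set
InE n k v = ∃ λ (i : Fin n) → v ≡ i ↑ˡ k

-- Write N = M ⊕ U. Every independent set of N of size below r = (d + m) + (e + m)
-- extends by one element (in M, or freely in U), so the independent sets of τ^m N are
-- the independent sets of N of size at most r − m, and its bases those of size exactly r − m.
-- As E precedes E′, a circuit or cocircuit whose smallest element lies in E′ is contained
-- in E′. An externally active v ∈ E′ thus has a circuit C ⊆ (B ∩ E′) ∪ {v} which meets E
-- trivially yet is dependent in τ^m N; hence |C| > e + m, which forces |B ∩ E′| = e + m and
-- |B ∩ E| = d. If v ∈ E′ is internally active and |B ∩ E| < d + m, augmenting B ∩ E in M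
-- by some y gives a basis B − v + y of τ^m N disjoint from the cocircuit of v: impossible.

module Submission where

open import Defs
open import Data.Bool using (_∨_)
open import Data.Nat using (ℕ; zero; suc; _+_; _≤_; _<_; s≤s; _<?_)
open import Data.Nat.Properties
open import Data.Fin using (Fin; zero; suc; _↑ˡ_; _↑ʳ_; splitAt)
open import Data.Fin.Properties using (splitAt-↑ˡ; splitAt-↑ʳ; splitAt⁻¹-↑ˡ; splitAt⁻¹-↑ʳ)
open import Data.Fin.Subset
  using (Subset; ∣_∣; ⊥; ⁅_⁆; _∈_; _∉_; _⊆_; ∁; _∩_; _∪_; _─_; _-_; Empty; inside; outside)
open import Data.Fin.Subset.Properties
  using (∪-identityʳ; p⊆p∪q; p─⊥≡p; p─q⊆p; drop-∷-⊆; Empty-unique; ∣⊥∣≡0; x∈⁅x⁆; x∈⁅y⁆⇒x≡y;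
         x∈p∪q⁻; x∈p∪q⁺; x∈p∩q⁻; x∈∁p⇒x∉p; p⊆q⇒∣p∣≤∣q∣)
open import Data.Vec using ([]; _∷_; here; there; take; drop)
open import Data.Vec.Properties using (take-zipWith; drop-zipWith)
open import Data.Product using (_×_; _,_; ∃; proj₁; proj₂)
open import Data.Sum using (inj₁; inj₂; map₁)
open import Function using (_∘_)
open import Relation.Nullary using (¬_; yes; no; contradiction)
open import Relation.Binary.Definitions using (Asymmetric)
open import Relation.Binary.PropositionalEquality
  using (_≡_; _≢_; refl; sym; trans; cong; subst; module ≡-Reasoning)
open import Relation.Binary.Structures using (IsStrictTotalOrder)

private
  variable
    n k : ℕ

x∉p⇒∣p∪⁅x⁆∣≡1+∣p∣ : {p : Subset n} {x : Fin n} → x ∉ p → ∣ p ∪ ⁅ x ⁆ ∣ ≡ suc ∣ p ∣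
x∉p⇒∣p∪⁅x⁆∣≡1+∣p∣ {p = inside  ∷ p} {zero}  x∉p = contradiction here x∉p
x∉p⇒∣p∪⁅x⁆∣≡1+∣p∣ {p = outside ∷ p} {zero}  x∉p = cong (suc ∘ ∣_∣) (∪-identityʳ p)
x∉p⇒∣p∪⁅x⁆∣≡1+∣p∣ {p = inside  ∷ p} {suc x} x∉p = cong suc (x∉p⇒∣p∪⁅x⁆∣≡1+∣p∣ (x∉p ∘ there))
x∉p⇒∣p∪⁅x⁆∣≡1+∣p∣ {p = outside ∷ p} {suc x} x∉p = x∉p⇒∣p∪⁅x⁆∣≡1+∣p∣ (x∉p ∘ there)

x∈p⇒1+∣p-x∣≡∣p∣ : {p : Subset n} {x : Fin n} → x ∈ p → suc ∣ p - x ∣ ≡ ∣ p ∣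
x∈p⇒1+∣p-x∣≡∣p∣ {p = inside  ∷ p} here          = cong (suc ∘ ∣_∣) (p─⊥≡p p)
x∈p⇒1+∣p-x∣≡∣p∣ {p = inside  ∷ p} (there x∈p) = cong suc (x∈p⇒1+∣p-x∣≡∣p∣ x∈p)
x∈p⇒1+∣p-x∣≡∣p∣ {p = outside ∷ p} (there x∈p) = x∈p⇒1+∣p-x∣≡∣p∣ x∈p

x∈p─q⇒x∉q : (p q : Subset n) {x : Fin n} → x ∈ p ─ q → x ∉ q
x∈p─q⇒x∉q (inside ∷ p) (outside ∷ q) here ()
x∈p─q⇒x∉q (_ ∷ p) (_ ∷ q) (there x∈p─q) (there x∈q) = x∈p─q⇒x∉q p q x∈p─q x∈q

p⊆q∧∣q∣≤∣p∣⇒q≡p : {p q : Subset n} → p ⊆ q → ∣ q ∣ ≤ ∣ p ∣ → q ≡ p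
p⊆q∧∣q∣≤∣p∣⇒q≡p {p = []}          {[]}          _   _         = refl
p⊆q∧∣q∣≤∣p∣⇒q≡p {p = inside  ∷ p} {inside  ∷ q} p⊆q (s≤s ∣q∣≤∣p∣) =
  cong (inside ∷_) (p⊆q∧∣q∣≤∣p∣⇒q≡p (drop-∷-⊆ p⊆q) ∣q∣≤∣p∣)
p⊆q∧∣q∣≤∣p∣⇒q≡p {p = inside  ∷ p} {outside ∷ q} p⊆q _ with () ← p⊆q here
p⊆q∧∣q∣≤∣p∣⇒q≡p {p = outside ∷ p} {inside  ∷ q} p⊆q ∣q∣≤∣p∣ =
  contradiction ∣q∣≤∣p∣ (<⇒≱ (s≤s (p⊆q⇒∣p∣≤∣q∣ (drop-∷-⊆ p⊆q))))
p⊆q∧∣q∣≤∣p∣⇒q≡p {p = outside ∷ p} {outside ∷ q} p⊆q ∣q∣≤∣p∣ =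
  cong (outside ∷_) (p⊆q∧∣q∣≤∣p∣⇒q≡p (drop-∷-⊆ p⊆q) ∣q∣≤∣p∣)

∣p∣<n⇒∃x∉p : (p : Subset n) → ∣ p ∣ < n → ∃ λ x → x ∉ p
∣p∣<n⇒∃x∉p (outside ∷ p) _ = zero , λ ()
∣p∣<n⇒∃x∉p (inside ∷ p) (s≤s ∣p∣<n) with x , x∉p ← ∣p∣<n⇒∃x∉p p ∣p∣<n =
  suc x , x∉p ∘ λ { (there x∈p) → x∈p }

↑ˡ≢↑ʳ : (i : Fin n) (j : Fin k) → i ↑ˡ k ≢ n ↑ʳ j
↑ˡ≢↑ʳ {n} {k} i j eq
  with () ← trans (sym (splitAt-↑ˡ n i k)) (trans (cong (splitAt n) eq) (splitAt-↑ʳ n k j))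

InE-of-¬↑ʳ : {A : Fin (n + k) → Set} → (∀ j → ¬ A (n ↑ʳ j)) → ∀ v → A v → InE n k v
InE-of-¬↑ʳ {n} {k} {A} ¬A v Av with splitAt n v in eq
... | inj₁ i = i , sym (splitAt⁻¹-↑ˡ eq)
... | inj₂ j = contradiction (subst A (sym (splitAt⁻¹-↑ʳ eq)) Av) (¬A j)

↑ˡ∈⇒∈take : {S : Subset (n + k)} {i : Fin n} → i ↑ˡ k ∈ S → i ∈ take n S
↑ˡ∈⇒∈take {S = _ ∷ _} {zero}  here        = here
↑ˡ∈⇒∈take {S = _ ∷ _} {suc i} (there i∈S) = there (↑ˡ∈⇒∈take i∈S)

∈take⇒↑ˡ∈ : {S : Subset (n + k)} {i : Fin n} → i ∈ take n S → i ↑ˡ k ∈ S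
∈take⇒↑ˡ∈ {S = _ ∷ _} {zero}  here        = here
∈take⇒↑ˡ∈ {S = _ ∷ _} {suc i} (there i∈S) = there (∈take⇒↑ˡ∈ i∈S)

↑ʳ∈⇒∈drop : {S : Subset (n + k)} {j : Fin k} → n ↑ʳ j ∈ S → j ∈ drop n S
↑ʳ∈⇒∈drop {zero}              j∈S         = j∈S
↑ʳ∈⇒∈drop {suc n} {S = _ ∷ _} (there j∈S) = ↑ʳ∈⇒∈drop j∈S

∈drop⇒↑ʳ∈ : {S : Subset (n + k)} {j : Fin k} → j ∈ drop n S → n ↑ʳ j ∈ S
∈drop⇒↑ʳ∈ {zero}              j∈S = j∈S
∈drop⇒↑ʳ∈ {suc n} {S = _ ∷ _} j∈S = there (∈drop⇒↑ʳ∈ j∈S)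

take-⊆ : {S S′ : Subset (n + k)} → S ⊆ S′ → take n S ⊆ take n S′
take-⊆ S⊆S′ = ↑ˡ∈⇒∈take ∘ S⊆S′ ∘ ∈take⇒↑ˡ∈

drop-⊆ : {S S′ : Subset (n + k)} → S ⊆ S′ → drop n S ⊆ drop n S′
drop-⊆ S⊆S′ = ↑ʳ∈⇒∈drop ∘ S⊆S′ ∘ ∈drop⇒↑ʳ∈

∣S∣≡∣take∣+∣drop∣ : ∀ n (S : Subset (n + k)) → ∣ S ∣ ≡ ∣ take n S ∣ + ∣ drop n S ∣
∣S∣≡∣take∣+∣drop∣ zero    S             = refl
∣S∣≡∣take∣+∣drop∣ (suc n) (inside  ∷ S) = cong suc (∣S∣≡∣take∣+∣drop∣ n S)
∣S∣≡∣take∣+∣drop∣ (suc n) (outside ∷ S) = ∣S∣≡∣take∣+∣drop∣ n S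

take-⊥ : take n (⊥ {n + k}) ≡ ⊥
take-⊥ {zero}  = refl
take-⊥ {suc n} = cong (outside ∷_) take-⊥

drop-⊥ : drop n (⊥ {n + k}) ≡ ⊥
drop-⊥ {zero}  = refl
drop-⊥ {suc n} = drop-⊥ {n}

take-⁅↑ˡ⁆ : (i : Fin n) → take n ⁅ i ↑ˡ k ⁆ ≡ ⁅ i ⁆
take-⁅↑ˡ⁆ zero    = cong (inside ∷_) take-⊥
take-⁅↑ˡ⁆ (suc i) = cong (outside ∷_) (take-⁅↑ˡ⁆ i)

drop-⁅↑ˡ⁆ : (i : Fin n) → drop n ⁅ i ↑ˡ k ⁆ ≡ ⊥
drop-⁅↑ˡ⁆ {suc n} zero    = drop-⊥ {n}
drop-⁅↑ˡ⁆         (suc i) = drop-⁅↑ˡ⁆ i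

take-⁅↑ʳ⁆ : (j : Fin k) → take n ⁅ n ↑ʳ j ⁆ ≡ ⊥
take-⁅↑ʳ⁆ {n = zero}  j = refl
take-⁅↑ʳ⁆ {n = suc n} j = cong (outside ∷_) (take-⁅↑ʳ⁆ j)

drop-⁅↑ʳ⁆ : (j : Fin k) → drop n ⁅ n ↑ʳ j ⁆ ≡ ⁅ j ⁆
drop-⁅↑ʳ⁆ {n = zero}  j = refl
drop-⁅↑ʳ⁆ {n = suc n} j = drop-⁅↑ʳ⁆ {n = n} j

take-∪⁅↑ˡ⁆ : (S : Subset (n + k)) (i : Fin n) → take n (S ∪ ⁅ i ↑ˡ k ⁆) ≡ take n S ∪ ⁅ i ⁆
take-∪⁅↑ˡ⁆ {n} S i = trans (take-zipWith _∨_ S _) (cong (take n S ∪_) (take-⁅↑ˡ⁆ i))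

drop-∪⁅↑ˡ⁆ : (S : Subset (n + k)) (i : Fin n) → drop n (S ∪ ⁅ i ↑ˡ k ⁆) ≡ drop n S
drop-∪⁅↑ˡ⁆ {n} S i =
  trans (drop-zipWith _∨_ S _) (trans (cong (drop n S ∪_) (drop-⁅↑ˡ⁆ i)) (∪-identityʳ _))

take-∪⁅↑ʳ⁆ : (S : Subset (n + k)) (j : Fin k) → take n (S ∪ ⁅ n ↑ʳ j ⁆) ≡ take n S
take-∪⁅↑ʳ⁆ {n} S j =
  trans (take-zipWith _∨_ S _) (trans (cong (take n S ∪_) (take-⁅↑ʳ⁆ j)) (∪-identityʳ _))

drop-∪⁅↑ʳ⁆ : (S : Subset (n + k)) (j : Fin k) → drop n (S ∪ ⁅ n ↑ʳ j ⁆) ≡ drop n S ∪ ⁅ j ⁆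
drop-∪⁅↑ʳ⁆ {n} S j = trans (drop-zipWith _∨_ S _) (cong (drop n S ∪_) (drop-⁅↑ʳ⁆ {n = n} j))

Hereditary : IndepPred n → Set
Hereditary P = ∀ I J → J ⊆ I → P I → P J

RankBounded : IndepPred n → ℕ → Set
RankBounded P r = ∀ I → P I → ∣ I ∣ ≤ r

Growable : IndepPred n → ℕ → Set
Growable P r = ∀ I → P I → ∣ I ∣ < r → ∃ λ x → x ∉ I × P (I ∪ ⁅ x ⁆)

matroid-growable : {P : IndepPred n} {r : ℕ} → IsMatroid P → HasRank P r → Growable P r
matroid-growable isM ((I₀ , PI₀ , ∣I₀∣≡r) , _) I PI ∣I∣<r
  with x , _ , x∉I , P[I∪x] ←
         IsMatroid.augment isM I I₀ PI PI₀ (subst (∣ I ∣ <_) (sym ∣I₀∣≡r) ∣I∣<r)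
  = x , x∉I , P[I∪x]

uniform-hereditary : (r : ℕ) → Hereditary (uniform k r)
uniform-hereditary r I J J⊆I ∣I∣≤r = ≤-trans (p⊆q⇒∣p∣≤∣q∣ J⊆I) ∣I∣≤r

uniform-growable : {r : ℕ} → r ≤ k → Growable (uniform k r) r
uniform-growable r≤k I _ ∣I∣<r with x , x∉I ← ∣p∣<n⇒∃x∉p I (<-≤-trans ∣I∣<r r≤k) =
  x , x∉I , subst (_≤ _) (sym (x∉p⇒∣p∪⁅x⁆∣≡1+∣p∣ x∉I)) ∣I∣<r

module _ {P : IndepPred n} {Q : IndepPred k} where

  directSum-hereditary : Hereditary P → Hereditary Q → Hereditary (directSum P Q)
  directSum-hereditary hP hQ I J J⊆I (PI , QI) = hP _ _ (take-⊆ J⊆I) PI , hQ _ _ (drop-⊆ J⊆I) QI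

  directSum-rankBounded : {r s : ℕ} → RankBounded P r → RankBounded Q s →
                          RankBounded (directSum P Q) (r + s)
  directSum-rankBounded {r} {s} bP bQ I (PI , QI) =
    subst (_≤ r + s) (sym (∣S∣≡∣take∣+∣drop∣ n I)) (+-mono-≤ (bP _ PI) (bQ _ QI))

  directSum-∪⁅↑ˡ⁆ : {S : Subset (n + k)} {i : Fin n} →
                    P (take n S ∪ ⁅ i ⁆) → Q (drop n S) → directSum P Q (S ∪ ⁅ i ↑ˡ k ⁆)
  directSum-∪⁅↑ˡ⁆ {S} {i} P′ QS =
    subst P (sym (take-∪⁅↑ˡ⁆ S i)) P′ , subst Q (sym (drop-∪⁅↑ˡ⁆ S i)) QS

  directSum-∪⁅↑ʳ⁆ : {S : Subset (n + k)} {j : Fin k} →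
                    P (take n S) → Q (drop n S ∪ ⁅ j ⁆) → directSum P Q (S ∪ ⁅ n ↑ʳ j ⁆)
  directSum-∪⁅↑ʳ⁆ {S} {j} PS Q′ =
    subst P (sym (take-∪⁅↑ʳ⁆ S j)) PS , subst Q (sym (drop-∪⁅↑ʳ⁆ S j)) Q′

  directSum-growable : {r s : ℕ} → Growable P r → Growable Q s → Growable (directSum P Q) (r + s)
  directSum-growable {r} {s} growP growQ I (PI , QI) ∣I∣<r+s with ∣ take n I ∣ <? r
  ... | yes ∣take∣<r with i , i∉ , P′ ← growP _ PI ∣take∣<r =
    i ↑ˡ k , i∉ ∘ ↑ˡ∈⇒∈take , directSum-∪⁅↑ˡ⁆ P′ QI
  ... | no ∣take∣≮r with ∣ drop n I ∣ <? s
  ...   | yes ∣drop∣<s with j , j∉ , Q′ ← growQ _ QI ∣drop∣<s =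
    n ↑ʳ j , j∉ ∘ ↑ʳ∈⇒∈drop , directSum-∪⁅↑ʳ⁆ PI Q′
  ...   | no ∣drop∣≮s = contradiction ∣I∣<r+s (≤⇒≯ (subst (r + s ≤_) (sym (∣S∣≡∣take∣+∣drop∣ n I))
                                                     (+-mono-≤ (≮⇒≥ ∣take∣≮r) (≮⇒≥ ∣drop∣≮s))))

module Truncation {P : IndepPred n} {r : ℕ}
                  (bounded : RankBounded P r) (growable : Growable P r) where

  truncIter⁻ : ∀ j I → truncIter j P I → P I × ∣ I ∣ + j ≤ r
  rankSized⇒maximal : ∀ j I → ∣ I ∣ + j ≡ r → ∀ J → I ⊆ J → truncIter j P J → J ≡ I

  truncIter⁻ zero I PI = PI , subst (_≤ r) (sym (+-identityʳ _)) (bounded I PI)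
  truncIter⁻ (suc j) I (TI , ¬basis) with PI , ∣I∣+j≤r ← truncIter⁻ j I TI
                                     with m≤n⇒m<n∨m≡n ∣I∣+j≤r
  ... | inj₁ ∣I∣+j<r = PI , subst (_≤ r) (sym (+-suc ∣ I ∣ j)) ∣I∣+j<r
  ... | inj₂ ∣I∣+j≡r = contradiction (TI , rankSized⇒maximal j I ∣I∣+j≡r) ¬basis

  rankSized⇒maximal j I ∣I∣+j≡r J I⊆J TJ = p⊆q∧∣q∣≤∣p∣⇒q≡p I⊆J (+-cancelʳ-≤ j _ _ ∣J∣+j≤∣I∣+j)
    where
    ∣J∣+j≤∣I∣+j : ∣ J ∣ + j ≤ ∣ I ∣ + j
    ∣J∣+j≤∣I∣+j = subst (∣ J ∣ + j ≤_) (sym ∣I∣+j≡r) (proj₂ (truncIter⁻ j J TJ))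

  truncIter⁺ : ∀ j I → P I → ∣ I ∣ + j ≤ r → truncIter j P I
  undersized⇒¬isBasis : ∀ j I → P I → ∣ I ∣ + j < r → ¬ IsBasis (truncIter j P) I

  truncIter⁺ zero    I PI _          = PI
  truncIter⁺ (suc j) I PI ∣I∣+1+j≤r =
    truncIter⁺ j I PI (≤-trans (+-monoʳ-≤ ∣ I ∣ (n≤1+n j)) ∣I∣+1+j≤r) ,
    undersized⇒¬isBasis j I PI (subst (_≤ r) (+-suc ∣ I ∣ j) ∣I∣+1+j≤r)

  undersized⇒¬isBasis j I PI ∣I∣+j<r (_ , maximal)
    with x , x∉I , P[I∪x] ← growable I PI (≤-<-trans (m≤m+n ∣ I ∣ j) ∣I∣+j<r) =
    x∉I (subst (x ∈_) I∪x≡I (x∈p∪q⁺ (inj₂ (x∈⁅x⁆ x))))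
    where
    I∪x≡I : I ∪ ⁅ x ⁆ ≡ I
    I∪x≡I = maximal _ (p⊆p∪q _) (truncIter⁺ j _ P[I∪x]
              (subst (λ c → c + j ≤ r) (sym (x∉p⇒∣p∪⁅x⁆∣≡1+∣p∣ x∉I)) ∣I∣+j<r))

  isBasis-truncIter⁻ : ∀ j B → IsBasis (truncIter j P) B → P B × ∣ B ∣ + j ≡ r
  isBasis-truncIter⁻ j B basis@(TB , _) with PB , ∣B∣+j≤r ← truncIter⁻ j B TB =
    PB , ≤∧≮⇒≡ ∣B∣+j≤r (λ ∣B∣+j<r → undersized⇒¬isBasis j B PB ∣B∣+j<r basis)

  isBasis-truncIter⁺ : ∀ j B → P B → ∣ B ∣ + j ≡ r → IsBasis (truncIter j P) B
  isBasis-truncIter⁺ j B PB ∣B∣+j≡r =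
    truncIter⁺ j B PB (≤-reflexive ∣B∣+j≡r) , rankSized⇒maximal j B ∣B∣+j≡r

module TruncatedSum (d m s : ℕ) {M : IndepPred n} (isM : IsMatroid M)
                    (rank : HasRank M (d + m)) (s≤k : s ≤ k) where

  open IsMatroid isM

  N : IndepPred (n + k)
  N = directSum M (uniform k s)

  open Truncation {P = N} (directSum-rankBounded (proj₂ rank) (λ _ ∣I∣≤s → ∣I∣≤s))
                          (directSum-growable (matroid-growable isM rank) (uniform-growable s≤k))

  module Activities {_≺_ : Fin (n + k) → Fin (n + k) → Set} (≺-asym : Asymmetric _≺_)
           (E≺E′ : ∀ (i : Fin n) (j : Fin k) → (i ↑ˡ k) ≺ (n ↑ʳ j)) where

    smallest-↑ʳ⇒↑ˡ∉ : ∀ {j C} → IsSmallest _≺_ (n ↑ʳ j) C → ∀ i → i ↑ˡ k ∉ C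
    smallest-↑ʳ⇒↑ˡ∉ {j} (_ , smallest) i i↑ˡk∈C = ≺-asym (E≺E′ i j) (smallest _ i↑ˡk∈C (↑ˡ≢↑ʳ i j))

    externallyActive-↑ʳ⇒∣take∣≡d : ∀ {B j} → IsBasis (truncIter m N) B →
      ExternallyActive (truncIter m N) _≺_ B (n ↑ʳ j) → ∣ take n B ∣ ≡ d
    externallyActive-↑ʳ⇒∣take∣≡d {B} {j} basis (v∉B , C , (¬TC , _) , C⊆B∪v , smallest) =
      +-cancelʳ-≡ (s + m) _ _ ∣takeB∣+[s+m]≡d+[s+m]
      where
      NB = proj₁ (isBasis-truncIter⁻ m B basis)
      ∣B∣+m≡d+m+s = proj₂ (isBasis-truncIter⁻ m B basis)

      takeC≡⊥ : take n C ≡ ⊥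
      takeC≡⊥ = Empty-unique λ (i , i∈takeC) → smallest-↑ʳ⇒↑ˡ∉ smallest i (∈take⇒↑ˡ∈ i∈takeC)

      ∣C∣≡∣dropC∣ : ∣ C ∣ ≡ ∣ drop n C ∣
      ∣C∣≡∣dropC∣ = trans (∣S∣≡∣take∣+∣drop∣ n C)
                          (cong (_+ ∣ drop n C ∣) (trans (cong ∣_∣ takeC≡⊥) (∣⊥∣≡0 n)))

      s<∣dropC∣ : s < ∣ drop n C ∣
      s<∣dropC∣ = ≰⇒> λ ∣dropC∣≤s →
        ¬TC (truncIter⁺ m C (subst M (sym takeC≡⊥) empty-indep , ∣dropC∣≤s) (begin
          ∣ C ∣ + m          ≡⟨ cong (_+ m) ∣C∣≡∣dropC∣ ⟩
          ∣ drop n C ∣ + m   ≤⟨ +-monoˡ-≤ m ∣dropC∣≤s ⟩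
          s + m              ≤⟨ +-monoʳ-≤ s (m≤n+m m d) ⟩
          s + (d + m)        ≡⟨ +-comm s (d + m) ⟩
          d + m + s          ∎))
        where open ≤-Reasoning

      dropC⊆dropB∪j : drop n C ⊆ drop n B ∪ ⁅ j ⁆
      dropC⊆dropB∪j = subst (drop n C ⊆_) (drop-∪⁅↑ʳ⁆ B j) (drop-⊆ {n = n} C⊆B∪v)

      j∉dropB : j ∉ drop n B
      j∉dropB = v∉B ∘ ∈drop⇒↑ʳ∈ {n = n}

      ∣dropB∣≡s : ∣ drop n B ∣ ≡ s
      ∣dropB∣≡s = ≤-antisym (proj₂ NB) (≤-pred (≤-trans s<∣dropC∣ (subst (∣ drop n C ∣ ≤_)
                    (x∉p⇒∣p∪⁅x⁆∣≡1+∣p∣ j∉dropB) (p⊆q⇒∣p∣≤∣q∣ dropC⊆dropB∪j))))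

      ∣takeB∣+[s+m]≡d+[s+m] : ∣ take n B ∣ + (s + m) ≡ d + (s + m)
      ∣takeB∣+[s+m]≡d+[s+m] = begin
        ∣ take n B ∣ + (s + m)             ≡⟨ +-assoc ∣ take n B ∣ s m ⟨
        ∣ take n B ∣ + s + m               ≡⟨ cong (λ c → ∣ take n B ∣ + c + m) ∣dropB∣≡s ⟨
        ∣ take n B ∣ + ∣ drop n B ∣ + m    ≡⟨ cong (_+ m) (∣S∣≡∣take∣+∣drop∣ n B) ⟨
        ∣ B ∣ + m                          ≡⟨ ∣B∣+m≡d+m+s ⟩
        d + m + s                          ≡⟨ +-assoc d m s ⟩
        d + (m + s)                        ≡⟨ cong (d +_) (+-comm m s) ⟩
        d + (s + m)                        ∎
        where open ≡-Reasoning

    internallyActive-↑ʳ⇒∣take∣≡d+m : ∀ {B j} → IsBasis (truncIter m N) B →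
      InternallyActive (truncIter m N) _≺_ B (n ↑ʳ j) → ∣ take n B ∣ ≡ d + m
    internallyActive-↑ʳ⇒∣take∣≡d+m {B} {j} basis (v∈B , D , (¬coindepD , _) , D⊆∁B∪v , smallest) =
      ≤∧≮⇒≡ (proj₂ rank _ MtakeB) (¬coindepD ∘ exchange)
      where
      NB = proj₁ (isBasis-truncIter⁻ m B basis)
      MtakeB = proj₁ NB
      ∣B∣+m≡d+m+s = proj₂ (isBasis-truncIter⁻ m B basis)
      v = n ↑ʳ j

      exchange : ∣ take n B ∣ < d + m → dual (truncIter m N) D
      exchange ∣takeB∣<d+m
        with y , y∉takeB , M[takeB∪y] ← matroid-growable isM rank _ MtakeB ∣takeB∣<d+m =
        B′ , isBasis-truncIter⁺ m B′ NB′ (trans (cong (_+ m) ∣B′∣≡∣B∣) ∣B∣+m≡d+m+s) , D∩B′-empty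
        where
        B′ = (B - v) ∪ ⁅ y ↑ˡ k ⁆

        N[B∪y] : N (B ∪ ⁅ y ↑ˡ k ⁆)
        N[B∪y] = directSum-∪⁅↑ˡ⁆ {P = M} {Q = uniform k s} M[takeB∪y] (proj₂ NB)

        NB′ : N B′
        NB′ = directSum-hereditary hereditary (uniform-hereditary s) _ B′
                (x∈p∪q⁺ ∘ map₁ (p─q⊆p B _) ∘ x∈p∪q⁻ _ _) N[B∪y]

        ∣B′∣≡∣B∣ : ∣ B′ ∣ ≡ ∣ B ∣
        ∣B′∣≡∣B∣ = trans (x∉p⇒∣p∪⁅x⁆∣≡1+∣p∣ (y∉takeB ∘ ↑ˡ∈⇒∈take ∘ p─q⊆p B _)) (x∈p⇒1+∣p-x∣≡∣p∣ v∈B)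

        D∩B′-empty : Empty (D ∩ B′)
        D∩B′-empty (x , x∈D∩B′) with x∈D , x∈B′ ← x∈p∩q⁻ D B′ x∈D∩B′ | x∈p∪q⁻ (B - v) _ x∈B′
        ... | inj₂ x∈⁅y⁆ = smallest-↑ʳ⇒↑ˡ∉ smallest y (subst (_∈ D) (x∈⁅y⁆⇒x≡y _ x∈⁅y⁆) x∈D)
        ... | inj₁ x∈B-v with x∈p∪q⁻ (∁ B) _ (D⊆∁B∪v x∈D)
        ...   | inj₁ x∈∁B = x∈∁p⇒x∉p x∈∁B (p─q⊆p B _ x∈B-v)
        ...   | inj₂ x∈⁅v⁆ = x∈p─q⇒x∉q B ⁅ v ⁆ x∈B-v x∈⁅v⁆

lemma4p2 : (m d e n k : ℕ) → 0 < m →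
    (M : IndepPred n) → IsMatroid M → HasRank M (d + m) →
    e + m ≤ k →
    (_≺_ : Fin (n + k) → Fin (n + k) → Set) → IsStrictTotalOrder _≡_ _≺_ →
    (∀ (i : Fin n) (j : Fin k) → (i ↑ˡ k) ≺ (n ↑ʳ j)) →
    (B : Subset (n + k)) →
    IsBasis (truncIter m (directSum M (uniform k (e + m)))) B →
    ((∣ take n B ∣ ≢ d) →
      ∀ v → ExternallyActive (truncIter m (directSum M (uniform k (e + m)))) _≺_ B v →
        InE n k v)
    × ((∣ take n B ∣ ≢ d + m) →
      ∀ v → InternallyActive (truncIter m (directSum M (uniform k (e + m)))) _≺_ B v →
        InE n k v)
lemma4p2 m d e n k _ M isM rank e+m≤k _≺_ ≺-sto E≺E′ B basis =
    (λ ∣takeB∣≢d → InE-of-¬↑ʳ λ _ → ∣takeB∣≢d ∘ externallyActive-↑ʳ⇒∣take∣≡d basis)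
  , (λ ∣takeB∣≢d+m → InE-of-¬↑ʳ λ _ → ∣takeB∣≢d+m ∘ internallyActive-↑ʳ⇒∣take∣≡d+m basis)
  where
  open TruncatedSum d m (e + m) isM rank e+m≤k
  open Activities (λ {x y} → IsStrictTotalOrder.asym ≺-sto {x} {y}) E≺E′
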